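{- For every prime power $q$ and integer $r\ge0$, $\overline{\mathrm{ex}}_q(r,0)=(q-1)^r$. Furthermore, any matrix $M$ over $F_q$ with no zero entries, of rank $r$, with $(q-1)^r$ distinct columns, has $r$ rows $\mathbf{u}_1,\dots,\mathbf{u}_r$ such that every row of $M$ is a scalar multiple of some $\mathbf{u}_i$.
   Context: $F_q$ is the finite field with $q$ elements. $\overline{\mathrm{ex}}_q(r,0)$ is the maximum number of distinct columns of a matrix over $F_q$ (any number of rows) of rank at most $r$ none of whose entries is $0$. -}

module Defs where

open import Level using (Level; _⊔_)
open import Data.Nat using (ℕ; _≤_; _∸_; _^_)
import Data.Nat as ℕ
open import Data.Fin using (Fin; zero; suc)
open import Data.Product using (Σ; ∃; _×_; _,_)
open import Relation.Nullary using (¬_)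
open import Relation.Binary.PropositionalEquality using (_≡_)
open import Algebra.Bundles using (CommutativeRing)

record Field (c ℓ : Level) : Set (Level.suc (c ⊔ ℓ)) where
  field
    commRing : CommutativeRing c ℓ
  open CommutativeRing commRing public
  field
    0≉1      : ¬ (0# ≈ 1#)
    inverse  : ∀ x → ¬ (x ≈ 0#) → ∃ λ y → x * y ≈ 1#

HasSize : ∀ {c ℓ} → Field c ℓ → ℕ → Set (c ⊔ ℓ)
HasSize F q = Σ (Fin q → Carrier) λ enum →
    (∀ x → ∃ λ i → enum i ≈ x) × (∀ i j → enum i ≈ enum j → i ≡ j)
  where open Field F

module _ {c ℓ} (F : Field c ℓ) where
  open Field F using (Carrier; _≈_; _+_; _*_; 0#; 1#)

  -- Matrix with m rows and n columns, M i j = entry in row i, column j.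
  Matrix : ℕ → ℕ → Set c
  Matrix m n = Fin m → Fin n → Carrier

  sumF : ∀ {k} → (Fin k → Carrier) → Carrier
  sumF {ℕ.zero}  f = 0#
  sumF {ℕ.suc k} f = f zero + sumF (λ i → f (suc i))

  LinIndep : ∀ {m k} → (Fin k → Fin m → Carrier) → Set (c ⊔ ℓ)
  LinIndep {m} {k} v = ∀ (a : Fin k → Carrier) →
    (∀ j → sumF (λ i → a i * v i j) ≈ 0#) → ∀ i → a i ≈ 0#

  col : ∀ {m n} → Matrix m n → Fin n → Fin m → Carrier
  col M k j = M j k

  RankAtMost : ∀ {m n} → Matrix m n → ℕ → Set (c ⊔ ℓ)
  RankAtMost {m} {n} M r = ∀ (s : Fin (ℕ.suc r) → Fin n) → ¬ LinIndep (λ i → col M (s i))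

  HasRank : ∀ {m n} → Matrix m n → ℕ → Set (c ⊔ ℓ)
  HasRank {m} {n} M r =
    (∃ λ (s : Fin r → Fin n) → LinIndep (λ i → col M (s i))) × RankAtMost M r

  NoZeroEntries : ∀ {m n} → Matrix m n → Set ℓ
  NoZeroEntries M = ∀ i j → ¬ (M i j ≈ 0#)

  DistinctColumns : ∀ {m n} → Matrix m n → Set ℓ
  DistinctColumns {m} {n} M = ∀ k k' → (∀ j → M j k ≈ M j k') → k ≡ k'

  -- Candidate matrices for exbar_q(r,0) with m rows and n columns.
  Admissible : ∀ {m n} → Matrix m n → ℕ → Set (c ⊔ ℓ)
  Admissible M r = NoZeroEntries M × DistinctColumns M × RankAtMost M r

module Submission where

open import Defs
open import Level using (_⊔_)
open import Data.Nat as ℕ using (ℕ; zero; suc; _≤_; _∸_; _^_; NonZero)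
import Data.Nat.Properties as ℕ
open import Data.Fin as Fin using (Fin; zero; suc; punchIn; punchOut; _↑ʳ_; funToFin; finToFun)
import Data.Fin.Properties as Fin
import Data.Integer as ℤ
open import Data.Product using (Σ; ∃; _×_; _,_; proj₁; proj₂)
open import Data.Sum using (_⊎_; inj₁; inj₂)
open import Data.Empty using (⊥-elim)
open import Data.Vec.Functional using (_∷_; insertAt; updateAt)
open import Data.Vec.Functional.Properties
  using (insertAt-lookup; insertAt-punchIn; updateAt-updates; updateAt-minimal)
open import Function using (_∘_; const)
open import Relation.Nullary using (¬_; Dec; yes; no; ¬?; contradiction)
open import Relation.Nullary.Decidable using (_×-dec_; decidable-stable; map′)
open import Relation.Binary.Definitions using (Decidable)
open import Relation.Binary.PropositionalEquality using (_≡_; _≢_)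
import Relation.Binary.PropositionalEquality as ≡
open import Algebra.Bundles using (CommutativeRing)

-- Let F be a finite field with 1 + p elements (p = q − 1 nonzero ones).  The central notion
-- is a row basis of a matrix M: t rows ρ and t columns σ such that the minor M[ρ,σ] has
-- independent columns and every column of M is determined by its entries in the rows ρ.
-- It is built row by row (FiniteField.Extend): a new row joins, with a new column, when some
-- bordered minor is independent, and otherwise it is determined by the rows already chosen.
-- (1) The σ-columns are independent, so t ≤ rank M ≤ r; a column without zero entries is
--     coded by its ρ-part, a word of length t over the p nonzero elements, so n ≤ p^t ≤ p^r.
-- (2) The columns of the matrix of all vectors of Fʳ with nonzero entries are distinct, and
--     its rank is ≤ r since r + 1 vectors of Fʳ are dependent (Gaussian elimination).
-- (3) If n = p^r and F has an element α ∉ {0, 1}, then p^r ≤ p^t forces t = r, every nonzero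
--     pattern on the rows ρ occurs in some column, and differences of such columns give
--     vectors e_a of the column space that are the unit vectors on ρ (FiniteField.Extremal).
--     So row j is Σ_a e_a(j) · row ρ_a, and changing a single ρ-entry of a column shows that
--     it is a multiple of one row ρ_a, lest some column get a zero entry.  If F = F₂ the
--     matrix has a single column and the claim is checked directly (singleColumn).

-- The canonical ring morphism ℤ → R, with which the library's ring solver
-- (Algebra.Solver.Ring) normalises identities in any commutative ring.
module IntegerCoefficients {c ℓ} (R : CommutativeRing c ℓ) where
  open CommutativeRing R
  open import Data.Integer using (ℤ; +_; -[1+_]; _⊖_; _◃_; sign; ∣_∣)
  import Data.Integer.Properties as ℤ
  open import Data.Sign as Sign using (Sign)
  open import Data.Maybe using (Maybe; just; nothing)
  open import Algebra.Properties.Semiring.Mult.TCOptimised semiring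
    using (×-homo-+; ×1-homo-*; 1+×) renaming (_×_ to _×′_)
  open import Algebra.Properties.Ring ring
    using (-‿involutive; -0#≈0#; -‿distribˡ-*; -‿distribʳ-*; -‿+-comm)
  open import Algebra.Properties.CommutativeSemigroup +-commutativeSemigroup
    renaming (interchange to +-interchange)
  open import Algebra.Properties.CommutativeSemigroup *-commutativeSemigroup
    renaming (interchange to *-interchange)
  open import Relation.Binary.Reasoning.Setoid setoid
  import Algebra.Solver.Ring.AlmostCommutativeRing as ACR

  fromℕ : ℕ → Carrier
  fromℕ n = n ×′ 1#

  fromℤ : ℤ → Carrier
  fromℤ (+ n)    = fromℕ n
  fromℤ -[1+ n ] = - fromℕ (suc n)

  fromℤ-⊖ : ∀ m n → fromℤ (m ⊖ n) ≈ fromℕ m - fromℕ n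
  fromℤ-⊖ zero    zero    = sym (-‿inverseʳ 0#)
  fromℤ-⊖ (suc m) zero    = sym (trans (+-congˡ -0#≈0#) (+-identityʳ _))
  fromℤ-⊖ zero    (suc n) = sym (+-identityˡ _)
  fromℤ-⊖ (suc m) (suc n) = begin
    fromℤ (suc m ⊖ suc n)                    ≡⟨ ≡.cong fromℤ (ℤ.[1+m]⊖[1+n]≡m⊖n m n) ⟩
    fromℤ (m ⊖ n)                            ≈⟨ fromℤ-⊖ m n ⟩
    fromℕ m - fromℕ n                        ≈⟨ +-identityˡ _ ⟨
    0# + (fromℕ m - fromℕ n)                 ≈⟨ +-congʳ (-‿inverseʳ 1#) ⟨
    (1# - 1#) + (fromℕ m - fromℕ n)          ≈⟨ +-interchange 1# (- 1#) _ _ ⟩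
    (1# + fromℕ m) + (- 1# - fromℕ n)        ≈⟨ +-congˡ (-‿+-comm 1# (fromℕ n)) ⟩
    (1# + fromℕ m) - (1# + fromℕ n)          ≈⟨ +-cong (1+× m 1#) (-‿cong (1+× n 1#)) ⟨
    fromℕ (suc m) - fromℕ (suc n)            ∎

  fromℤ-+ : ∀ i j → fromℤ (i ℤ.+ j) ≈ fromℤ i + fromℤ j
  fromℤ-+ (+ m)    (+ n)    = ×-homo-+ 1# m n
  fromℤ-+ (+ m)    -[1+ n ] = fromℤ-⊖ m (suc n)
  fromℤ-+ -[1+ m ] (+ n)    = trans (fromℤ-⊖ n (suc m)) (+-comm _ _)
  fromℤ-+ -[1+ m ] -[1+ n ] = begin
    - fromℕ (suc (suc (m ℕ.+ n)))   ≡⟨ ≡.cong (λ k → - fromℕ (suc k)) (ℕ.+-suc m n) ⟨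
    - fromℕ (suc m ℕ.+ suc n)       ≈⟨ -‿cong (×-homo-+ 1# (suc m) (suc n)) ⟩
    - (fromℕ (suc m) + fromℕ (suc n)) ≈⟨ -‿+-comm _ _ ⟨
    - fromℕ (suc m) - fromℕ (suc n) ∎

  -- Products are handled through the decomposition i = sign i · ∣ i ∣.
  fromSign : Sign → Carrier
  fromSign Sign.+ = 1#
  fromSign Sign.- = - 1#

  fromSign-* : ∀ s s' → fromSign (s Sign.* s') ≈ fromSign s * fromSign s'
  fromSign-* Sign.+ s'     = sym (*-identityˡ _)
  fromSign-* Sign.- Sign.+ = sym (*-identityʳ _)
  fromSign-* Sign.- Sign.- = begin
    1#                ≈⟨ -‿involutive 1# ⟨
    - - 1#            ≈⟨ -‿cong (*-identityʳ (- 1#)) ⟨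
    - (- 1# * 1#)     ≈⟨ -‿distribʳ-* (- 1#) 1# ⟩
    - 1# * - 1#       ∎

  fromℤ-◃ : ∀ s n → fromℤ (s ◃ n) ≈ fromSign s * fromℕ n
  fromℤ-◃ s       zero    = sym (zeroʳ _)
  fromℤ-◃ Sign.+  (suc n) = sym (*-identityˡ _)
  fromℤ-◃ Sign.-  (suc n) = trans (-‿cong (sym (*-identityˡ _))) (-‿distribˡ-* 1# _)

  fromℤ-signAbs : ∀ i → fromℤ i ≈ fromSign (sign i) * fromℕ ∣ i ∣
  fromℤ-signAbs (+ n)    = sym (*-identityˡ _)
  fromℤ-signAbs -[1+ n ] = trans (-‿cong (sym (*-identityˡ _))) (-‿distribˡ-* 1# _)

  fromℤ-* : ∀ i j → fromℤ (i ℤ.* j) ≈ fromℤ i * fromℤ j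
  fromℤ-* i j = begin
    fromℤ (sign i Sign.* sign j ◃ ∣ i ∣ ℕ.* ∣ j ∣)
      ≈⟨ fromℤ-◃ (sign i Sign.* sign j) (∣ i ∣ ℕ.* ∣ j ∣) ⟩
    fromSign (sign i Sign.* sign j) * fromℕ (∣ i ∣ ℕ.* ∣ j ∣)
      ≈⟨ *-cong (fromSign-* (sign i) (sign j)) (×1-homo-* ∣ i ∣ ∣ j ∣) ⟩
    (fromSign (sign i) * fromSign (sign j)) * (fromℕ ∣ i ∣ * fromℕ ∣ j ∣)
      ≈⟨ *-interchange _ _ _ _ ⟩
    (fromSign (sign i) * fromℕ ∣ i ∣) * (fromSign (sign j) * fromℕ ∣ j ∣)
      ≈⟨ *-cong (fromℤ-signAbs i) (fromℤ-signAbs j) ⟨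
    fromℤ i * fromℤ j ∎

  fromℤ-neg : ∀ i → fromℤ (ℤ.- i) ≈ - fromℤ i
  fromℤ-neg (+ zero)  = sym -0#≈0#
  fromℤ-neg (+ suc n) = refl
  fromℤ-neg -[1+ n ]  = sym (-‿involutive _)

  morphism : ACR._-Raw-AlmostCommutative⟶_ ℤ.+-*-rawRing (ACR.fromCommutativeRing R)
  morphism = record
    { ⟦_⟧ = fromℤ ; +-homo = fromℤ-+ ; *-homo = fromℤ-* ; -‿homo = fromℤ-neg
    ; 0-homo = refl ; 1-homo = refl }

  coefficient-equality : ∀ i j → Maybe (fromℤ i ≈ fromℤ j)
  coefficient-equality i j with i ℤ.≟ j
  ... | yes ≡.refl = just refl
  ... | no _       = nothing

  open import Algebra.Solver.Ring ℤ.+-*-rawRing (ACR.fromCommutativeRing R) morphism coefficient-equality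
    public

module LinearAlgebra {c ℓ} (F : Field c ℓ) where
  open Field F hiding (zero)
  open IntegerCoefficients commRing using (solve; _:=_; _:+_; _:*_; _:-_; :-_)
  open import Algebra.Properties.Ring ring using ([y-z]x≈yx-zx; -1*x≈-x)
  open import Algebra.Properties.AbelianGroup +-abelianGroup using (x∙y⁻¹≈ε⇒x≈y; inverseʳ-unique)
  import Algebra.Properties.Semiring.Sum semiring as Sum
  open Sum using (sum)
  open import Relation.Binary.Reasoning.Setoid setoid

  C : Set c
  C = Carrier

  1≉0 : ¬ 1# ≈ 0#
  1≉0 = 0≉1 ∘ sym

  _⁻¹⟨_⟩ : ∀ x → ¬ x ≈ 0# → C
  x ⁻¹⟨ x≉0 ⟩ = proj₁ (inverse x x≉0)

  *-inverseʳ : ∀ x (x≉0 : ¬ x ≈ 0#) → x * x ⁻¹⟨ x≉0 ⟩ ≈ 1#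
  *-inverseʳ x x≉0 = proj₂ (inverse x x≉0)

  *-inverse-cancel : ∀ x y (y≉0 : ¬ y ≈ 0#) → (x * y ⁻¹⟨ y≉0 ⟩) * y ≈ x
  *-inverse-cancel x y y≉0 = begin
    (x * y⁻¹) * y   ≈⟨ *-assoc x y⁻¹ y ⟩
    x * (y⁻¹ * y)   ≈⟨ *-congˡ (trans (*-comm y⁻¹ y) (*-inverseʳ y y≉0)) ⟩
    x * 1#          ≈⟨ *-identityʳ x ⟩
    x               ∎
    where y⁻¹ = y ⁻¹⟨ y≉0 ⟩

  *-cancel-zero : ∀ {x y} → ¬ x ≈ 0# → x * y ≈ 0# → y ≈ 0#
  *-cancel-zero {x} {y} x≉0 xy≈0 = begin
    y                          ≈⟨ *-inverse-cancel y x x≉0 ⟨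
    (y * x⁻¹) * x              ≈⟨ solve 3 (λ y i x → (y :* i) :* x := i :* (x :* y)) refl y x⁻¹ x ⟩
    x⁻¹ * (x * y)              ≈⟨ *-congˡ xy≈0 ⟩
    x⁻¹ * 0#                   ≈⟨ zeroʳ x⁻¹ ⟩
    0#                         ∎
    where x⁻¹ = x ⁻¹⟨ x≉0 ⟩

  x-y≈0⇒x≈y : ∀ {x y} → x - y ≈ 0# → x ≈ y
  x-y≈0⇒x≈y = x∙y⁻¹≈ε⇒x≈y _ _

  -- Finite sums: Defs' sumF coincides with the library's sum, whose lemmas we reuse.
  ∑ : ∀ {k} → (Fin k → C) → C
  ∑ = sumF F

  ∑≡sum : ∀ {k} (f : Fin k → C) → ∑ f ≡ sum f
  ∑≡sum {zero}  f = ≡.refl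
  ∑≡sum {suc k} f = ≡.cong (f zero +_) (∑≡sum (f ∘ suc))

  via-sum : ∀ {k} (f g : Fin k → C) → sum f ≈ sum g → ∑ f ≈ ∑ g
  via-sum f g eq = trans (reflexive (∑≡sum f)) (trans eq (reflexive (≡.sym (∑≡sum g))))

  ∑-cong : ∀ {k} {f g : Fin k → C} → (∀ i → f i ≈ g i) → ∑ f ≈ ∑ g
  ∑-cong {f = f} {g} f≈g = via-sum f g (Sum.sum-cong-≋ f≈g)

  ∑-zero : ∀ {k} {f : Fin k → C} → (∀ i → f i ≈ 0#) → ∑ f ≈ 0#
  ∑-zero {k} f≈0 =
    trans (∑-cong f≈0) (trans (reflexive (∑≡sum {k} (const 0#))) (Sum.sum-replicate-zero k))

  ∑-*ˡ : ∀ {k} x (f : Fin k → C) → x * ∑ f ≈ ∑ (λ i → x * f i)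
  ∑-*ˡ x f = trans (*-congˡ (reflexive (∑≡sum f)))
                   (trans (Sum.*-distribˡ-sum x f) (reflexive (≡.sym (∑≡sum (λ i → x * f i)))))

  ∑-comm : ∀ {k l} (f : Fin k → Fin l → C) → ∑ (λ a → ∑ (f a)) ≈ ∑ (λ b → ∑ (λ a → f a b))
  ∑-comm f = begin
    ∑ (λ a → ∑ (f a))               ≡⟨ ∑≡sum (λ a → ∑ (f a)) ⟩
    sum (λ a → ∑ (f a))             ≡⟨ Sum.sum-cong-≗ (λ a → ∑≡sum (f a)) ⟩
    sum (λ a → sum (f a))           ≈⟨ Sum.∑-comm f ⟩
    sum (λ b → sum (λ a → f a b))   ≡⟨ Sum.sum-cong-≗ (λ b → ∑≡sum (λ a → f a b)) ⟨
    sum (λ b → ∑ (λ a → f a b))     ≡⟨ ∑≡sum (λ b → ∑ (λ a → f a b)) ⟨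
    ∑ (λ b → ∑ (λ a → f a b))       ∎

  ∑-*ʳ : ∀ {k} x (f : Fin k → C) → ∑ f * x ≈ ∑ (λ i → f i * x)
  ∑-*ʳ x f = trans (*-congʳ (reflexive (∑≡sum f)))
                   (trans (Sum.*-distribʳ-sum x f) (reflexive (≡.sym (∑≡sum (λ i → f i * x)))))

  ∑-− : ∀ {k} (f g : Fin k → C) → ∑ f - ∑ g ≈ ∑ (λ i → f i - g i)
  ∑-− {zero}  f g = -‿inverseʳ 0#
  ∑-− {suc k} f g = begin
    (f zero + ∑ (f ∘ suc)) - (g zero + ∑ (g ∘ suc))
      ≈⟨ solve 4 (λ x X y Y → (x :+ X) :- (y :+ Y) := (x :- y) :+ (X :- Y)) refl _ _ _ _ ⟩
    (f zero - g zero) + (∑ (f ∘ suc) - ∑ (g ∘ suc))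
      ≈⟨ +-congˡ (∑-− (f ∘ suc) (g ∘ suc)) ⟩
    (f zero - g zero) + ∑ (λ i → f (suc i) - g (suc i)) ∎

  ∑-remove : ∀ {k} (f : Fin (suc k) → C) q → ∑ f ≈ f q + ∑ (f ∘ punchIn q)
  ∑-remove f q = begin
    ∑ f                          ≡⟨ ∑≡sum f ⟩
    sum f                        ≈⟨ Sum.sum-remove {i = q} f ⟩
    f q + sum (f ∘ punchIn q)    ≡⟨ ≡.cong (f q +_) (∑≡sum (f ∘ punchIn q)) ⟨
    f q + ∑ (f ∘ punchIn q)      ∎

  ∑-delta : ∀ {k} (f : Fin k → C) q → (∀ i → i ≢ q → f i ≈ 0#) → ∑ f ≈ f q
  ∑-delta {suc k} f q f≈0 = begin
    ∑ f                          ≈⟨ ∑-remove f q ⟩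
    f q + ∑ (f ∘ punchIn q)      ≈⟨ +-congˡ (∑-zero (λ i → f≈0 _ (Fin.punchInᵢ≢i q i))) ⟩
    f q + 0#                     ≈⟨ +-identityʳ (f q) ⟩
    f q                          ∎

  lincomb : ∀ {k m} → (Fin k → C) → (Fin k → Fin m → C) → Fin m → C
  lincomb a v j = ∑ (λ i → a i * v i j)

  lincomb-cong : ∀ {k m} {a b : Fin k → C} (v : Fin k → Fin m → C) →
                 (∀ i → a i ≈ b i) → ∀ j → lincomb a v j ≈ lincomb b v j
  lincomb-cong v a≈b j = ∑-cong (λ i → *-congʳ (a≈b i))

  lincomb-− : ∀ {k m} (a b : Fin k → C) (v : Fin k → Fin m → C) j →
              lincomb a v j - lincomb b v j ≈ lincomb (λ i → a i - b i) v j
  lincomb-− a b v j = trans (∑-− (λ i → a i * v i j) (λ i → b i * v i j))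
                            (∑-cong (λ i → sym ([y-z]x≈yx-zx (v i j) (a i) (b i))))

  lincomb-* : ∀ {k m} x (a : Fin k → C) (v : Fin k → Fin m → C) j →
              x * lincomb a v j ≈ lincomb (λ i → x * a i) v j
  lincomb-* x a v j = trans (∑-*ˡ x (λ i → a i * v i j))
                            (∑-cong (λ i → sym (*-assoc x (a i) (v i j))))

  lincomb-lincomb : ∀ {s k m} (x : Fin s → C) (a : Fin s → Fin k → C) (v : Fin k → Fin m → C) j →
                    ∑ (λ b → x b * lincomb (a b) v j) ≈ lincomb (λ i → ∑ (λ b → x b * a b i)) v j
  lincomb-lincomb x a v j = begin
    ∑ (λ b → x b * lincomb (a b) v j)
      ≈⟨ ∑-cong (λ b → lincomb-* (x b) (a b) v j) ⟩
    ∑ (λ b → ∑ (λ i → (x b * a b i) * v i j))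
      ≈⟨ ∑-comm (λ b i → (x b * a b i) * v i j) ⟩
    ∑ (λ i → ∑ (λ b → (x b * a b i) * v i j))
      ≈⟨ ∑-cong (λ i → ∑-*ʳ (v i j) (λ b → x b * a b i)) ⟨
    lincomb (λ i → ∑ (λ b → x b * a b i)) v j ∎

  lincomb-0∷ : ∀ {k m} (a : Fin k → C) (v : Fin (suc k) → Fin m → C) j →
               lincomb (0# ∷ a) v j ≈ lincomb a (v ∘ suc) j
  lincomb-0∷ a v j = trans (+-congʳ (zeroˡ (v zero j))) (+-identityˡ _)

  IsRelation : ∀ {k m} → (Fin k → Fin m → C) → (Fin k → C) → Set ℓ
  IsRelation v a = (∀ j → lincomb a v j ≈ 0#) × ∃ λ i → ¬ a i ≈ 0#

  relation-cong : ∀ {k m} (v : Fin k → Fin m → C) {a b : Fin k → C} →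
                  (∀ i → a i ≈ b i) → IsRelation v a → IsRelation v b
  relation-cong v a≈b (rel , i , aᵢ≉0) =
    (λ j → trans (sym (lincomb-cong v a≈b j)) (rel j)) , i , aᵢ≉0 ∘ trans (a≈b i)

  Dependent : ∀ {k m} → (Fin k → Fin m → C) → Set (c ⊔ ℓ)
  Dependent {k} v = Σ (Fin k → C) (IsRelation v)

  InSpan : ∀ {k m} → (Fin k → Fin m → C) → (Fin m → C) → Set (c ⊔ ℓ)
  InSpan {k} v w = Σ (Fin k → C) λ a → ∀ j → w j ≈ lincomb a v j

  dependent⇒¬independent : ∀ {k m} {v : Fin k → Fin m → C} → Dependent v → ¬ LinIndep F v
  dependent⇒¬independent (a , rel , i , aᵢ≉0) indep = aᵢ≉0 (indep a rel i)

  independent-restrict : ∀ {k m m'} {v : Fin k → Fin m → C} (π : Fin m' → Fin m) →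
                         LinIndep F (λ i l → v i (π l)) → LinIndep F v
  independent-restrict π indep a rel = indep a (rel ∘ π)

  independent-tail : ∀ {k m} {v : Fin (suc k) → Fin m → C} → LinIndep F v → LinIndep F (v ∘ suc)
  independent-tail {v = v} indep a rel i =
    indep (0# ∷ a) (λ j → trans (lincomb-0∷ a v j) (rel j)) (suc i)

  independent-drop : ∀ d {k m} {v : Fin (d ℕ.+ k) → Fin m → C} →
                     LinIndep F v → LinIndep F (λ i → v (d ↑ʳ i))
  independent-drop zero    indep = indep
  independent-drop (suc d) {v = v} indep = independent-drop d (independent-tail {v = v} indep)

  independent≤rank : ∀ {m n r t} {M : Matrix F m n} → RankAtMost F M r →
                     (σ : Fin t → Fin n) → LinIndep F (λ i → col F M (σ i)) → t ≤ r
  independent≤rank {n = n} {r} {t} {M} rank σ indep = ℕ.≮⇒≥ r≮t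
    where
    too-many : ∀ {t} d → d ℕ.+ suc r ≡ t → (σ : Fin t → Fin n) →
               ¬ LinIndep F (λ i → col F M (σ i))
    too-many d ≡.refl σ indep = rank (σ ∘ (d ↑ʳ_)) (independent-drop d indep)
    r≮t : ¬ r ℕ.< t
    r≮t r<t = too-many (t ∸ suc r) (ℕ.m∸n+n≡m r<t) σ indep

  span-agreement : ∀ {k m m'} {v : Fin k → Fin m → C} (π : Fin m' → Fin m) →
                   LinIndep F (λ i l → v i (π l)) → ∀ {w w'} → InSpan v w → InSpan v w' →
                   (∀ l → w (π l) ≈ w' (π l)) → ∀ j → w j ≈ w' j
  span-agreement {v = v} π indep {w} {w'} (a , w≈) (b , w'≈) agree j = begin
    w j            ≈⟨ w≈ j ⟩
    lincomb a v j  ≈⟨ lincomb-cong v a≈b j ⟩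
    lincomb b v j  ≈⟨ w'≈ j ⟨
    w' j           ∎
    where
    difference-vanishes : ∀ l → lincomb (λ i → a i - b i) v (π l) ≈ 0#
    difference-vanishes l = begin
      lincomb (λ i → a i - b i) v (π l)      ≈⟨ lincomb-− a b v (π l) ⟨
      lincomb a v (π l) - lincomb b v (π l)  ≈⟨ +-cong (w≈ (π l)) (-‿cong (w'≈ (π l))) ⟨
      w (π l) - w' (π l)                     ≈⟨ +-congʳ (agree l) ⟩
      w' (π l) - w' (π l)                    ≈⟨ -‿inverseʳ (w' (π l)) ⟩
      0#                                     ∎
    a≈b : ∀ i → a i ≈ b i
    a≈b i = x-y≈0⇒x≈y (indep (λ i → a i - b i) difference-vanishes i)

  dependent-head-inSpan : ∀ {k m} {u : Fin (suc k) → Fin m → C} →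
                          LinIndep F (u ∘ suc) → Dependent u → InSpan (u ∘ suc) (u zero)
  dependent-head-inSpan {k} {u = u} indep (a , rel , i , aᵢ≉0) = coeff , u₀≈
    where
    a₀≉0 : ¬ a zero ≈ 0#
    a₀≉0 a₀≈0 = aᵢ≉0 (all-zero i)
      where
      tail-relation : ∀ j → lincomb (a ∘ suc) (u ∘ suc) j ≈ 0#
      tail-relation j =
        trans (sym (+-identityˡ _)) (trans (+-congʳ (sym (trans (*-congʳ a₀≈0) (zeroˡ _)))) (rel j))
      all-zero : ∀ i → a i ≈ 0#
      all-zero zero    = a₀≈0
      all-zero (suc i) = indep (a ∘ suc) tail-relation i
    π = a zero ⁻¹⟨ a₀≉0 ⟩
    coeff : Fin k → C
    coeff i = - π * a (suc i)
    u₀≈ : ∀ j → u zero j ≈ lincomb coeff (u ∘ suc) j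
    u₀≈ j = sym (begin
      lincomb coeff (u ∘ suc) j                  ≈⟨ lincomb-* (- π) (a ∘ suc) (u ∘ suc) j ⟨
      - π * lincomb (a ∘ suc) (u ∘ suc) j    ≈⟨ *-congˡ (inverseʳ-unique _ _ (rel j)) ⟩
      - π * - (a zero * u zero j)            ≈⟨ solve 3 (λ p a x → (:- p) :* (:- (a :* x)) := (a :* p) :* x)
                                                       refl π (a zero) (u zero j) ⟩
      (a zero * π) * u zero j                ≈⟨ *-congʳ (*-inverseʳ (a zero) a₀≉0) ⟩
      1# * u zero j                          ≈⟨ *-identityˡ (u zero j) ⟩
      u zero j                               ∎)

  inSpan-− : ∀ {k m} {v : Fin k → Fin m → C} {w w'} →
             InSpan v w → InSpan v w' → InSpan v (λ j → w j - w' j)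
  inSpan-− {v = v} (a , w≈) (b , w'≈) =
    (λ i → a i - b i) , λ j → trans (+-cong (w≈ j) (-‿cong (w'≈ j))) (lincomb-− a b v j)

  inSpan-* : ∀ {k m} {v : Fin k → Fin m → C} {w} x → InSpan v w → InSpan v (λ j → x * w j)
  inSpan-* {v = v} x (a , w≈) = (λ i → x * a i) , λ j → trans (*-congˡ (w≈ j)) (lincomb-* x a v j)

  inSpan-lincomb : ∀ {s k m} {v : Fin k → Fin m → C} (x : Fin s → C) {w : Fin s → Fin m → C} →
                   (∀ b → InSpan v (w b)) → InSpan v (lincomb x w)
  inSpan-lincomb {v = v} x spans =
    (λ i → ∑ (λ b → x b * proj₁ (spans b) i)) ,
    λ j → trans (∑-cong (λ b → *-congˡ (proj₂ (spans b) j)))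
                (lincomb-lincomb x (proj₁ ∘ spans) v j)

  dependent-cons : ∀ {k m} {v : Fin (suc k) → Fin m → C} → Dependent (v ∘ suc) → Dependent v
  dependent-cons {v = v} (a , rel , i , aᵢ≉0) =
    (0# ∷ a) , (λ j → trans (lincomb-0∷ a v j) (rel j)) , suc i , aᵢ≉0

  dependent-tail-coordinates : ∀ {k m} (v : Fin k → Fin (suc m) → C) → (∀ i → v i zero ≈ 0#) →
                               Dependent (λ i j → v i (suc j)) → Dependent v
  dependent-tail-coordinates v v₀≈0 (a , rel , nontrivial) = a , rel′ , nontrivial
    where
    rel′ : ∀ j → lincomb a v j ≈ 0#
    rel′ zero    = ∑-zero (λ i → trans (*-congˡ (v₀≈0 i)) (zeroʳ (a i)))
    rel′ (suc j) = rel j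

  dependent-eliminate : ∀ {k m} (v : Fin (suc k) → Fin m → C) q (c : Fin k → C) →
                        Dependent (λ i j → v (punchIn q i) j - c i * v q j) → Dependent v
  dependent-eliminate {k} v q c (a , rel , i , aᵢ≉0) = a′ , rel′ , punchIn q i , a′≉0
    where
    A = ∑ (λ i → a i * c i)
    a′ : Fin (suc k) → C
    a′ = insertAt a q (- A)
    a′≉0 : ¬ a′ (punchIn q i) ≈ 0#
    a′≉0 = aᵢ≉0 ∘ trans (reflexive (≡.sym (insertAt-punchIn a q (- A) i)))
    rel′ : ∀ j → lincomb a′ v j ≈ 0#
    rel′ j = begin
      lincomb a′ v j
        ≈⟨ ∑-remove (λ i → a′ i * v i j) q ⟩
      a′ q * v q j + ∑ (λ i → a′ (punchIn q i) * v (punchIn q i) j)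
        ≈⟨ +-cong (*-congʳ (reflexive (insertAt-lookup a q (- A))))
                  (∑-cong (λ i → *-congʳ (reflexive (insertAt-punchIn a q (- A) i)))) ⟩
      - A * v q j + ∑ (λ i → a i * v (punchIn q i) j)
        ≈⟨ solve 3 (λ A y S → (:- A) :* y :+ S := S :- A :* y) refl A (v q j) _ ⟩
      ∑ (λ i → a i * v (punchIn q i) j) - A * v q j
        ≈⟨ +-congˡ (-‿cong (∑-*ʳ (v q j) (λ i → a i * c i))) ⟩
      ∑ (λ i → a i * v (punchIn q i) j) - ∑ (λ i → (a i * c i) * v q j)
        ≈⟨ ∑-− (λ i → a i * v (punchIn q i) j) (λ i → (a i * c i) * v q j) ⟩
      ∑ (λ i → a i * v (punchIn q i) j - (a i * c i) * v q j)
        ≈⟨ ∑-cong (λ i → solve 4 (λ a x c y → a :* x :- (a :* c) :* y := a :* (x :- c :* y))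
                                 refl (a i) (v (punchIn q i) j) (c i) (v q j)) ⟩
      lincomb a (λ i j → v (punchIn q i) j - c i * v q j) j
        ≈⟨ rel j ⟩
      0# ∎

  nonzero-independent : ∀ {m} (w : Fin m → C) j → ¬ w j ≈ 0# → LinIndep F (λ (_ : Fin 1) → w)
  nonzero-independent w j wⱼ≉0 a rel zero =
    *-cancel-zero wⱼ≉0 (trans (*-comm (w j) (a zero)) (trans (sym (+-identityʳ _)) (rel j)))

  no-independent-in-F⁰ : ∀ {k} (v : Fin (suc k) → Fin 0 → C) → ¬ LinIndep F v
  no-independent-in-F⁰ v indep = 1≉0 (indep (const 1#) (λ ()) zero)

  repeated-dependent : ∀ {k m} (v : Fin (suc (suc k)) → Fin m → C) →
                       (∀ j → v zero j ≈ v (suc zero) j) → ¬ LinIndep F v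
  repeated-dependent v v₀≈v₁ indep = 1≉0 (indep a relation zero)
    where
    a = 1# ∷ (- 1# ∷ const 0#)
    relation : ∀ j → lincomb a v j ≈ 0#
    relation j = begin
      1# * v zero j + (- 1# * v (suc zero) j + ∑ (λ i → 0# * v (suc (suc i)) j))
        ≈⟨ +-cong (*-congˡ (v₀≈v₁ j))
                  (+-congˡ (∑-zero {f = λ i → 0# * v (suc (suc i)) j} (λ i → zeroˡ _))) ⟩
      1# * v₁ + (- 1# * v₁ + 0#)
        ≈⟨ +-cong (*-identityˡ v₁) (trans (+-identityʳ (- 1# * v₁)) (-1*x≈-x v₁)) ⟩
      v₁ - v₁
        ≈⟨ -‿inverseʳ v₁ ⟩
      0# ∎
      where v₁ = v (suc zero) j

  record RowBasis {m n} (M : Matrix F m n) : Set (c ⊔ ℓ) where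
    field
      t                 : ℕ
      ρ                 : Fin t → Fin m
      σ                 : Fin t → Fin n
      ρ-injective       : ∀ i i' → ρ i ≡ ρ i' → i ≡ i'
      minor-independent : LinIndep F (λ i l → M (ρ l) (σ i))
      determined        : ∀ k k' → (∀ i → M (ρ i) k ≈ M (ρ i) k') → ∀ j → M j k ≈ M j k'

  -- The basis columns σ are independent, so a row basis is no larger than the rank.
  basis≤rank : ∀ {m n r} {M : Matrix F m n} (B : RowBasis M) → RankAtMost F M r → RowBasis.t B ≤ r
  basis≤rank {M = M} B rank = independent≤rank {M = M} rank σ (independent-restrict ρ minor-independent)
    where open RowBasis B

  ScalarRowCover : ∀ {m n} → Matrix F m n → ℕ → Set (c ⊔ ℓ)
  ScalarRowCover {m} M r = Σ (Fin r → Fin m) λ u → (∀ i i' → u i ≡ u i' → i ≡ i') ×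
    (∀ j → ∃ λ i → ∃ λ λ' → ∀ k → M j k ≈ λ' * M (u i) k)

  singleColumn : ∀ {m n r} (M : Matrix F m n) (k₀ : Fin n) → (∀ k → k ≡ k₀) →
                 NoZeroEntries F M → HasRank F M r → ScalarRowCover M r
  singleColumn {zero}  {r = zero} M k₀ unique nz rank = (λ ()) , (λ ()) , (λ ())
  singleColumn {suc m} {r = zero} M k₀ unique nz (_ , rank≤0) =
    ⊥-elim (rank≤0 (const k₀) (nonzero-independent (col F M k₀) zero (nz zero k₀)))
  singleColumn {zero} {r = suc zero} M k₀ unique nz ((σ , indep) , _) =
    ⊥-elim (no-independent-in-F⁰ (λ i → col F M (σ i)) indep)
  singleColumn {suc m} {r = suc zero} M k₀ unique nz _ =
    const zero , (λ { zero zero _ → ≡.refl }) , λ j → zero , M j k₀ * π , row-multiple j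
    where
    π = M zero k₀ ⁻¹⟨ nz zero k₀ ⟩
    row-multiple : ∀ j k → M j k ≈ (M j k₀ * π) * M zero k
    row-multiple j k = ≡.subst (λ k → M j k ≈ (M j k₀ * π) * M zero k) (≡.sym (unique k))
                                (sym (*-inverse-cancel (M j k₀) (M zero k₀) (nz zero k₀)))
  singleColumn {r = suc (suc r)} M k₀ unique nz ((σ , indep) , _) =
    ⊥-elim (repeated-dependent (λ i → col F M (σ i)) same-column indep)
    where
    same-column : ∀ j → M j (σ zero) ≈ M j (σ (suc zero))
    same-column j = reflexive (≡.cong (M j) (≡.trans (unique _) (≡.sym (unique _))))

-- Over a field with decidable equality, any m + 1 vectors of Fᵐ are dependent
-- (Gaussian elimination on the first coordinate).
module DecidableEquality {c ℓ} (F : Field c ℓ) (_≈?_ : Decidable (Field._≈_ F)) where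
  open Field F hiding (zero)
  open LinearAlgebra F

  overdetermined : ∀ m (v : Fin (suc m) → Fin m → C) → Dependent v
  overdetermined zero    v = const 1# , (λ ()) , zero , 1≉0
  overdetermined (suc m) v with Fin.any? (λ q → ¬? (v q zero ≈? 0#))
  ... | yes (q , pivot≉0) =
    dependent-eliminate v q ratio
      (dependent-tail-coordinates w w₀≈0 (overdetermined m (λ i j → w i (suc j))))
    where
    ratio : Fin (suc m) → C
    ratio i = v (punchIn q i) zero * v q zero ⁻¹⟨ pivot≉0 ⟩
    -- subtract from every other vector the multiple of the pivot v q that kills its first entry
    w : Fin (suc m) → Fin (suc m) → C
    w i j = v (punchIn q i) j - ratio i * v q j
    w₀≈0 : ∀ i → w i zero ≈ 0#
    w₀≈0 i = trans (+-congˡ (-‿cong (*-inverse-cancel _ _ pivot≉0))) (-‿inverseʳ _)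
  ... | no no-pivot =
    dependent-cons {v = v}
      (dependent-tail-coordinates (v ∘ suc) v₀≈0 (overdetermined m (λ i j → v (suc i) (suc j))))
    where
    v₀≈0 : ∀ i → v (suc i) zero ≈ 0#
    v₀≈0 i = decidable-stable (v (suc i) zero ≈? 0#) (λ v₀≉0 → no-pivot (suc i , v₀≉0))

funToFin-injective : ∀ {k n} {g h : Fin k → Fin n} → funToFin g ≡ funToFin h → ∀ i → g i ≡ h i
funToFin-injective {g = g} {h} eq i = begin
  g i                       ≡⟨ Fin.finToFun-funToFin g i ⟨
  finToFun (funToFin g) i   ≡⟨ ≡.cong (λ x → finToFun x i) eq ⟩
  finToFun (funToFin h) i   ≡⟨ Fin.finToFun-funToFin h i ⟩
  h i                       ∎
  where open ≡.≡-Reasoning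

funToFin-cong : ∀ {k n} {g h : Fin k → Fin n} → (∀ i → g i ≡ h i) → funToFin g ≡ funToFin h
funToFin-cong {zero}  eq = ≡.refl
funToFin-cong {suc k} eq = ≡.cong₂ Fin.combine (eq zero) (funToFin-cong (eq ∘ suc))

injective⇒surjective : ∀ {n k} (g : Fin n → Fin k) → k ≤ n → (∀ {x y} → g x ≡ g y → x ≡ y) →
                       ∀ y → ∃ λ x → g x ≡ y
injective⇒surjective {n} {suc k} g k≤n g-injective y with Fin.any? (λ x → g x Fin.≟ y)
... | yes hit  = hit
... | no  miss = ⊥-elim (ℕ.<-irrefl ≡.refl (ℕ.≤-trans k≤n (Fin.injective⇒≤ avoid-y-injective)))
  where
  g≢y : ∀ x → y ≢ g x
  g≢y x eq = miss (x , ≡.sym eq)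
  avoid-y : Fin n → Fin k
  avoid-y x = punchOut (g≢y x)
  avoid-y-injective : ∀ {x x'} → avoid-y x ≡ avoid-y x' → x ≡ x'
  avoid-y-injective eq = g-injective (Fin.punchOut-injective (g≢y _) (g≢y _) eq)

module FiniteField {c ℓ} (F : Field c ℓ) (p : ℕ) (size : HasSize F (suc p)) where
  open Field F hiding (zero)
  open LinearAlgebra F
  open IntegerCoefficients commRing using (solve; _:=_; _:+_; _:*_; _:-_)

  -- The enumeration of F makes its equality decidable.
  enum : Fin (suc p) → C
  enum = proj₁ size

  index : C → Fin (suc p)
  index x = proj₁ (proj₁ (proj₂ size) x)

  enum-index : ∀ x → enum (index x) ≈ x
  enum-index x = proj₂ (proj₁ (proj₂ size) x)

  enum-injective : ∀ i j → enum i ≈ enum j → i ≡ j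
  enum-injective = proj₂ (proj₂ size)

  index-injective : ∀ {x y} → index x ≡ index y → x ≈ y
  index-injective {x} {y} eq = trans (sym (enum-index x)) (trans (reflexive (≡.cong enum eq)) (enum-index y))

  index-cong : ∀ {x y} → x ≈ y → index x ≡ index y
  index-cong {x} {y} x≈y = enum-injective _ _ (trans (enum-index x) (trans x≈y (sym (enum-index y))))

  _≈?_ : Decidable _≈_
  x ≈? y = map′ index-injective index-cong (index x Fin.≟ index y)

  open DecidableEquality F _≈?_ using (overdetermined)

  relation? : ∀ {k m} (v : Fin k → Fin m → C) a → Dec (IsRelation v a)
  relation? v a = Fin.all? (λ j → lincomb a v j ≈? 0#) ×-dec Fin.any? (λ i → ¬? (a i ≈? 0#))

  decode : ∀ {k} → Fin (suc p ^ k) → Fin k → C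
  decode x = enum ∘ finToFun x

  decode-encode : ∀ {k} (a : Fin k → C) i → decode (funToFin (index ∘ a)) i ≈ a i
  decode-encode a i =
    trans (reflexive (≡.cong enum (Fin.finToFun-funToFin (index ∘ a) i))) (enum-index (a i))

  -- By exhaustive search, a family of vectors is independent or has an explicit relation.
  independent-or-dependent : ∀ {k m} (v : Fin k → Fin m → C) → LinIndep F v ⊎ Dependent v
  independent-or-dependent v with Fin.any? (relation? v ∘ decode)
  ... | yes (x , rel) = inj₂ (decode x , rel)
  ... | no no-relation = inj₁ λ a rel i → decidable-stable (a i ≈? 0#) λ aᵢ≉0 →
    no-relation (funToFin (index ∘ a) ,
                 relation-cong v (λ i → sym (decode-encode a i)) (rel , i , aᵢ≉0))

  independent? : ∀ {k m} (v : Fin k → Fin m → C) → Dec (LinIndep F v)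
  independent? v with independent-or-dependent v
  ... | inj₁ indep = yes indep
  ... | inj₂ dep   = no (dependent⇒¬independent dep)

  ¬independent⇒dependent : ∀ {k m} (v : Fin k → Fin m → C) → ¬ LinIndep F v → Dependent v
  ¬independent⇒dependent v ¬indep with independent-or-dependent v
  ... | inj₁ indep = contradiction indep ¬indep
  ... | inj₂ dep   = dep

  nonzeroCode : ∀ x → ¬ x ≈ 0# → Fin p
  nonzeroCode x x≉0 = punchOut {i = index 0#} (x≉0 ∘ sym ∘ index-injective)

  nonzeroCode-injective : ∀ {x y} (x≉0 : ¬ x ≈ 0#) (y≉0 : ¬ y ≈ 0#) →
                          nonzeroCode x x≉0 ≡ nonzeroCode y y≉0 → x ≈ y
  nonzeroCode-injective x≉0 y≉0 eq =
    index-injective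
      (Fin.punchOut-injective (x≉0 ∘ sym ∘ index-injective) (y≉0 ∘ sym ∘ index-injective) eq)

  nonzeroElement : Fin p → C
  nonzeroElement i = enum (punchIn (index 0#) i)

  nonzeroElement-nonzero : ∀ i → ¬ nonzeroElement i ≈ 0#
  nonzeroElement-nonzero i eq =
    Fin.punchInᵢ≢i (index 0#) i (enum-injective _ _ (trans eq (sym (enum-index 0#))))

  nonzeroElement-injective : ∀ {i j} → nonzeroElement i ≈ nonzeroElement j → i ≡ j
  nonzeroElement-injective eq = Fin.punchIn-injective (index 0#) _ _ (enum-injective _ _ eq)

  -- 1 is nonzero, so p ≠ 0 (needed for the monotonicity of p ^_).
  instance
    p-nonZero : NonZero p
    p-nonZero = Fin.nonZeroIndex (nonzeroCode 1# 1≉0)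

  module Extend {m n} (M : Matrix F (suc m) n) (B : RowBasis (M ∘ suc)) where
    open RowBasis B

    rows : Fin (suc t) → Fin (suc m)
    rows = zero ∷ (suc ∘ ρ)

    bordered : Fin n → Fin (suc t) → Fin (suc t) → C
    bordered k i l = M (rows l) ((k ∷ σ) i)

    grow : ∀ k → LinIndep F (bordered k) → RowBasis M
    grow k indep = record
      { t = suc t ; ρ = rows ; σ = k ∷ σ ; ρ-injective = rows-injective
      ; minor-independent = indep ; determined = determined′ }
      where
      rows-injective : ∀ i i' → rows i ≡ rows i' → i ≡ i'
      rows-injective zero    zero     _  = ≡.refl
      rows-injective zero    (suc i') ()
      rows-injective (suc i) zero     ()
      rows-injective (suc i) (suc i') eq = ≡.cong suc (ρ-injective i i' (Fin.suc-injective eq))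
      determined′ : ∀ k k' → (∀ i → M (rows i) k ≈ M (rows i) k') → ∀ j → M j k ≈ M j k'
      determined′ k k' agree zero    = agree zero
      determined′ k k' agree (suc j) = determined k k' (agree ∘ suc) j

    -- Otherwise each column, restricted to the rows 0 ∷ ρ, lies in the span of the
    -- restricted columns σ; so row 0 is determined by the rows ρ and B still works.
    keep : (∀ k → ¬ LinIndep F (bordered k)) → RowBasis M
    keep none = record
      { t = t ; ρ = suc ∘ ρ ; σ = σ ; ρ-injective = λ i i' → ρ-injective i i' ∘ Fin.suc-injective
      ; minor-independent = minor-independent ; determined = determined′ }
      where
      minor : Fin t → Fin (suc t) → C
      minor i l = M (rows l) (σ i)
      column-inSpan : ∀ k → InSpan minor (λ l → M (rows l) k)
      column-inSpan k = dependent-head-inSpan {u = bordered k}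
        (independent-restrict suc minor-independent) (¬independent⇒dependent (bordered k) (none k))
      determined′ : ∀ k k' → (∀ i → M (suc (ρ i)) k ≈ M (suc (ρ i)) k') → ∀ j → M j k ≈ M j k'
      determined′ k k' agree zero    =
        span-agreement suc minor-independent (column-inSpan k) (column-inSpan k') agree zero
      determined′ k k' agree (suc j) = determined k k' agree j

    extended : RowBasis M
    extended with Fin.any? (λ k → independent? (bordered k))
    ... | yes (k , indep) = grow k indep
    ... | no  none        = keep (λ k indep → none (k , indep))

  rowBasis : ∀ {m n} (M : Matrix F m n) → RowBasis M
  rowBasis {zero}  M = record
    { t = 0 ; ρ = λ () ; σ = λ () ; ρ-injective = λ ()
    ; minor-independent = λ _ _ () ; determined = λ _ _ _ () }
  rowBasis {suc m} M = Extend.extended M (rowBasis (M ∘ suc))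

  module Coding {m n} {M : Matrix F m n} (B : RowBasis M) (nz : NoZeroEntries F M) where
    open RowBasis B

    code : Fin n → Fin (p ^ t)
    code k = funToFin (λ i → nonzeroCode (M (ρ i) k) (nz (ρ i) k))

    code-injective : DistinctColumns F M → ∀ {k k'} → code k ≡ code k' → k ≡ k'
    code-injective distinct {k} {k'} eq =
      distinct k k' (determined k k' λ i →
        nonzeroCode-injective (nz (ρ i) k) (nz (ρ i) k') (funToFin-injective eq i))

    columns≤ : DistinctColumns F M → n ≤ p ^ t
    columns≤ distinct = Fin.injective⇒≤ (code-injective distinct)

  upperBound : ∀ r m n (M : Matrix F m n) → Admissible F M r → n ≤ p ^ r
  upperBound r m n M (nz , distinct , rank) =
    ℕ.≤-trans (columns≤ distinct) (ℕ.^-monoʳ-≤ p (basis≤rank B rank))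
    where
    B = rowBasis M
    open Coding B nz

  -- Second claim: the r × p^r matrix whose columns are all the vectors of Fʳ with nonzero
  -- entries is admissible; its rank is ≤ r since r + 1 vectors of Fʳ are dependent.
  allNonzeroVectors : ∀ r → Matrix F r (p ^ r)
  allNonzeroVectors r j k = nonzeroElement (finToFun k j)

  attained : ∀ r → ∃ λ m → Σ (Matrix F m (p ^ r)) λ M → Admissible F M r
  attained r = r , M , nz , distinct , rank
    where
    M = allNonzeroVectors r
    nz : NoZeroEntries F M
    nz j k = nonzeroElement-nonzero (finToFun k j)
    distinct : DistinctColumns F M
    distinct k k' same = begin
      k                            ≡⟨ Fin.funToFin-finToFin {r} {p} k ⟨
      funToFin {r} (finToFun k)    ≡⟨ funToFin-cong (λ j → nonzeroElement-injective (same j)) ⟩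
      funToFin {r} (finToFun k')   ≡⟨ Fin.funToFin-finToFin {r} {p} k' ⟩
      k'                           ∎
      where open ≡.≡-Reasoning
    rank : RankAtMost F M r
    rank s = dependent⇒¬independent {v = columns} (overdetermined r columns)
      where
      columns : Fin (suc r) → Fin r → C
      columns i = col F M (s i)

  binaryOrThird : (∀ {x} → ¬ x ≈ 0# → x ≈ 1#) ⊎ (∃ λ α → ¬ α ≈ 0# × ¬ α ≈ 1#)
  binaryOrThird with Fin.any? (λ i → ¬? (enum i ≈? 0#) ×-dec ¬? (enum i ≈? 1#))
  ... | yes (i , third) = inj₂ (enum i , third)
  ... | no  none        = inj₁ λ {x} x≉0 → decidable-stable (x ≈? 1#) λ x≉1 →
    none (index x , x≉0 ∘ trans (sym (enum-index x)) , x≉1 ∘ trans (sym (enum-index x)))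

  -- An element outside {0, 1} is a second nonzero element.
  third⇒1<p : ∀ {α} → ¬ α ≈ 0# → ¬ α ≈ 1# → 1 ℕ.< p
  third⇒1<p {α} α≉0 α≉1 = Fin.injective⇒≤ {f = pair} pair-injective
    where
    pair : Fin 2 → Fin p
    pair zero       = nonzeroCode 1# 1≉0
    pair (suc zero) = nonzeroCode α α≉0
    pair-injective : ∀ {i j} → pair i ≡ pair j → i ≡ j
    pair-injective {zero}     {zero}     _  = ≡.refl
    pair-injective {zero}     {suc zero} eq = ⊥-elim (α≉1 (sym (nonzeroCode-injective 1≉0 α≉0 eq)))
    pair-injective {suc zero} {zero}     eq = ⊥-elim (α≉1 (nonzeroCode-injective α≉0 1≉0 eq))
    pair-injective {suc zero} {suc zero} _  = ≡.refl

  updateAt-nonzero : ∀ {t} (x : Fin t → C) a {y} → (∀ i → ¬ x i ≈ 0#) → ¬ y ≈ 0# →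
                     ∀ i → ¬ updateAt x a (const y) i ≈ 0#
  updateAt-nonzero x a x≉0 y≉0 i with i Fin.≟ a
  ... | yes ≡.refl = y≉0 ∘ trans (reflexive (≡.sym (updateAt-updates a x)))
  ... | no  i≢a    = x≉0 i ∘ trans (reflexive (≡.sym (updateAt-minimal i a x i≢a)))

  module Extremal {m n} (M : Matrix F m n) (B : RowBasis M) (nz : NoZeroEntries F M)
                  (distinct : DistinctColumns F M) (rank : RankAtMost F M (RowBasis.t B))
                  (enough : p ^ RowBasis.t B ≤ n) (α : C) (α≉0 : ¬ α ≈ 0#) (α≉1 : ¬ α ≈ 1#) where
    open RowBasis B
    open Coding B nz
    open import Relation.Binary.Reasoning.Setoid setoid

    -- The coding of columns is onto: every nonzero pattern on the rows ρ occurs.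
    realize : (x : Fin t → C) → (∀ i → ¬ x i ≈ 0#) → Σ (Fin n) λ k → ∀ i → M (ρ i) k ≈ x i
    realize x x≉0 = proj₁ hit , λ i →
      nonzeroCode-injective (nz (ρ i) (proj₁ hit)) (x≉0 i) (funToFin-injective (proj₂ hit) i)
      where
      hit = injective⇒surjective code enough (code-injective distinct)
              (funToFin (λ i → nonzeroCode (x i) (x≉0 i)))

    basisColumns : Fin t → Fin m → C
    basisColumns i = col F M (σ i)

    -- Every column lies in the span of the basis columns (rank ≤ t) ...
    column-inSpan : ∀ k → InSpan basisColumns (col F M k)
    column-inSpan k = dependent-head-inSpan {u = λ i → col F M ((k ∷ σ) i)}
      (independent-restrict ρ minor-independent)
      (¬independent⇒dependent (λ i → col F M ((k ∷ σ) i)) (rank (k ∷ σ)))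

    agreement : ∀ {w w'} → InSpan basisColumns w → InSpan basisColumns w' →
                (∀ i → w (ρ i) ≈ w' (ρ i)) → ∀ j → w j ≈ w' j
    agreement = span-agreement ρ minor-independent

    -- Columns k₁, equal to 1 on the rows ρ, and kα a, equal to α at ρ a and 1 elsewhere.
    ones : Fin t → C
    ones _ = 1#

    k₁ : Fin n
    k₁ = proj₁ (realize ones (const 1≉0))

    k₁-ones : ∀ i → M (ρ i) k₁ ≈ 1#
    k₁-ones = proj₂ (realize ones (const 1≉0))

    αAt : Fin t → Fin t → C
    αAt a = updateAt ones a (const α)

    kα : Fin t → Fin n
    kα a = proj₁ (realize (αAt a) (updateAt-nonzero ones a (const 1≉0) α≉0))

    kα-αAt : ∀ a i → M (ρ i) (kα a) ≈ αAt a i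
    kα-αAt a = proj₂ (realize (αAt a) (updateAt-nonzero ones a (const 1≉0) α≉0))

    α-1≉0 : ¬ α - 1# ≈ 0#
    α-1≉0 = α≉1 ∘ x-y≈0⇒x≈y

    γ : C
    γ = (α - 1#) ⁻¹⟨ α-1≉0 ⟩

    -- e a = γ (col (kα a) − col k₁) lies in the column space and is the unit vector
    -- at a on the rows ρ.
    e : Fin t → Fin m → C
    e a j = γ * (M j (kα a) - M j k₁)

    e-inSpan : ∀ a → InSpan basisColumns (e a)
    e-inSpan a = inSpan-* γ (inSpan-− (column-inSpan (kα a)) (column-inSpan k₁))

    e-diagonal : ∀ a → e a (ρ a) ≈ 1#
    e-diagonal a = begin
      γ * (M (ρ a) (kα a) - M (ρ a) k₁)
        ≈⟨ *-congˡ (+-cong (trans (kα-αAt a a) (reflexive (updateAt-updates a ones)))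
                           (-‿cong (k₁-ones a))) ⟩
      γ * (α - 1#)  ≈⟨ *-comm γ (α - 1#) ⟩
      (α - 1#) * γ  ≈⟨ *-inverseʳ (α - 1#) α-1≉0 ⟩
      1#            ∎

    e-offDiagonal : ∀ a i → i ≢ a → e a (ρ i) ≈ 0#
    e-offDiagonal a i i≢a = begin
      γ * (M (ρ i) (kα a) - M (ρ i) k₁)
        ≈⟨ *-congˡ (+-cong (trans (kα-αAt a i) (reflexive (updateAt-minimal i a ones i≢a)))
                           (-‿cong (k₁-ones i))) ⟩
      γ * (1# - 1#)  ≈⟨ *-congˡ (-‿inverseʳ 1#) ⟩
      γ * 0#         ≈⟨ zeroʳ γ ⟩
      0#             ∎

    -- Hence every column is the combination of the e a with its entries in the rows ρ,
    -- i.e. row j of M is Σₐ (e a j) · (row ρ a).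
    row-expansion : ∀ j k → M j k ≈ lincomb (λ a → M (ρ a) k) e j
    row-expansion j k = agreement (column-inSpan k) (inSpan-lincomb (λ a → M (ρ a) k) e-inSpan) on-ρ j
      where
      on-ρ : ∀ i → M (ρ i) k ≈ lincomb (λ a → M (ρ a) k) e (ρ i)
      on-ρ i = sym (begin
        lincomb (λ a → M (ρ a) k) e (ρ i)
          ≈⟨ ∑-delta (λ a → M (ρ a) k * e a (ρ i)) i
               (λ a a≢i → trans (*-congˡ (e-offDiagonal a i (a≢i ∘ ≡.sym))) (zeroʳ _)) ⟩
        M (ρ i) k * e i (ρ i)   ≈⟨ *-congˡ (e-diagonal i) ⟩
        M (ρ i) k * 1#          ≈⟨ *-identityʳ _ ⟩
        M (ρ i) k               ∎)

    single-change : ∀ {k k'} a → (∀ i → i ≢ a → M (ρ i) k' ≈ M (ρ i) k) →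
                    ∀ j → M j k' - M j k ≈ (M (ρ a) k' - M (ρ a) k) * e a j
    single-change {k} {k'} a same j = begin
      M j k' - M j k
        ≈⟨ +-cong (row-expansion j k') (-‿cong (row-expansion j k)) ⟩
      lincomb (λ i → M (ρ i) k') e j - lincomb (λ i → M (ρ i) k) e j
        ≈⟨ lincomb-− (λ i → M (ρ i) k') (λ i → M (ρ i) k) e j ⟩
      lincomb (λ i → M (ρ i) k' - M (ρ i) k) e j
        ≈⟨ ∑-delta (λ i → (M (ρ i) k' - M (ρ i) k) * e i j) a
             (λ i i≢a → trans (*-congʳ (trans (+-congʳ (same i i≢a)) (-‿inverseʳ _))) (zeroˡ _)) ⟩
      (M (ρ a) k' - M (ρ a) k) * e a j ∎

    -- Some e a j is nonzero, as row j has no zero entry.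
    some-coefficient : ∀ j → ∃ λ a → ¬ e a j ≈ 0#
    some-coefficient j with Fin.any? (λ a → ¬? (e a j ≈? 0#))
    ... | yes found = found
    ... | no  none  = ⊥-elim (nz j k₁ (trans (row-expansion j k₁) (∑-zero all-terms-zero)))
      where
      all-terms-zero : ∀ a → M (ρ a) k₁ * e a j ≈ 0#
      all-terms-zero a =
        trans (*-congˡ (decidable-stable (e a j ≈? 0#) (λ ≉0 → none (a , ≉0)))) (zeroʳ _)

    replace-entry : ∀ k a {y} → ¬ y ≈ 0# → ∃ λ k' → ∀ j → M j k' ≈ M j k + (y - M (ρ a) k) * e a j
    replace-entry k a {y} y≉0 = k' , λ j → begin
      M j k'                                    ≈⟨ solve 2 (λ u w → u := w :+ (u :- w)) refl (M j k') (M j k) ⟩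
      M j k + (M j k' - M j k)                  ≈⟨ +-congˡ (single-change a same j) ⟩
      M j k + (M (ρ a) k' - M (ρ a) k) * e a j  ≈⟨ +-congˡ (*-congʳ (+-congʳ k'-ρa)) ⟩
      M j k + (y - M (ρ a) k) * e a j           ∎
      where
      x : Fin t → C
      x i = M (ρ i) k
      replaced = realize (updateAt x a (const y)) (updateAt-nonzero x a (λ i → nz (ρ i) k) y≉0)
      k' = proj₁ replaced
      k'-ρa : M (ρ a) k' ≈ y
      k'-ρa = trans (proj₂ replaced a) (reflexive (updateAt-updates a x))
      same : ∀ i → i ≢ a → M (ρ i) k' ≈ M (ρ i) k
      same i i≢a = trans (proj₂ replaced i) (reflexive (updateAt-minimal i a x i≢a))

    -- If η = e a j ≠ 0, row j is η times row ρ a: otherwise some column k has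
    -- y = M (ρ a) k − M j k · η⁻¹ ≠ 0, and replacing its ρ a-entry by y creates a zero in row j.
    row-multiple : ∀ j a → ¬ e a j ≈ 0# → ∀ k → M j k ≈ e a j * M (ρ a) k
    row-multiple j a η≉0 k = begin
      M j k                ≈⟨ *-inverse-cancel (M j k) η η≉0 ⟨
      (M j k * η⁻¹) * η    ≈⟨ *-comm (M j k * η⁻¹) η ⟩
      η * (M j k * η⁻¹)    ≈⟨ *-congˡ (x-y≈0⇒x≈y (decidable-stable (y ≈? 0#) y≉0-impossible)) ⟨
      η * M (ρ a) k        ∎
      where
      η = e a j
      η⁻¹ = η ⁻¹⟨ η≉0 ⟩
      y = M (ρ a) k - M j k * η⁻¹
      cancels : M j k + (y - M (ρ a) k) * η ≈ 0#
      cancels = begin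
        M j k + (y - M (ρ a) k) * η    ≈⟨ solve 4 (λ w x i η → w :+ ((x :- w :* i) :- x) :* η := w :- w :* (η :* i))
                                                  refl (M j k) (M (ρ a) k) η⁻¹ η ⟩
        M j k - M j k * (η * η⁻¹)      ≈⟨ +-congˡ (-‿cong (*-congˡ (*-inverseʳ η η≉0))) ⟩
        M j k - M j k * 1#             ≈⟨ +-congˡ (-‿cong (*-identityʳ (M j k))) ⟩
        M j k - M j k                  ≈⟨ -‿inverseʳ (M j k) ⟩
        0#                             ∎
      y≉0-impossible : ¬ ¬ y ≈ 0#
      y≉0-impossible y≉0 = nz j (proj₁ replaced) (trans (proj₂ replaced j) cancels)
        where replaced = replace-entry k a y≉0

    cover : ScalarRowCover M t
    cover = ρ , ρ-injective , row-cover
      where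
      row-cover : ∀ j → ∃ λ i → ∃ λ λ' → ∀ k → M j k ≈ λ' * M (ρ i) k
      row-cover j with some-coefficient j
      ... | a , η≉0 = a , e a j , row-multiple j a η≉0

  -- If F = F₂ it has a single column;
  -- otherwise its row basis has exactly r rows (p^r ≤ p^t and t ≤ r) and Extremal applies.
  extremalStructure : ∀ r m (M : Matrix F m (p ^ r)) → NoZeroEntries F M → HasRank F M r →
                      DistinctColumns F M → ScalarRowCover M r
  extremalStructure r m M nz hasRank distinct with binaryOrThird
  ... | inj₁ binary = singleColumn M k₀ unique nz hasRank
    where
    k₀ : Fin (p ^ r)
    k₀ = funToFin {r} (const (nonzeroCode 1# 1≉0))
    unique : ∀ k → k ≡ k₀
    unique k = distinct k k₀ (λ j → trans (binary (nz j k)) (sym (binary (nz j k₀))))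
  ... | inj₂ (α , α≉0 , α≉1) =
    ≡.subst (ScalarRowCover M) t≡r
      (Extremal.cover M B nz distinct (≡.subst (RankAtMost F M) (≡.sym t≡r) rank)
                      (ℕ.≤-reflexive (≡.cong (p ^_) t≡r)) α α≉0 α≉1)
    where
    rank = proj₂ hasRank
    B = rowBasis M
    t = RowBasis.t B
    r≤t : r ≤ t
    r≤t = ℕ.≮⇒≥ λ t<r →
      ℕ.<⇒≱ (ℕ.^-monoʳ-< p (third⇒1<p α≉0 α≉1) t<r) (Coding.columns≤ B nz distinct)
    t≡r : t ≡ r
    t≡r = ℕ.≤-antisym (basis≤rank B rank) r≤t

-- A field has an element 0, so q = 1 + p, and the three claims are those of FiniteField.
corollary2 : ∀ {c ℓ} (F : Field c ℓ) (q : ℕ) → HasSize F q → (r : ℕ) →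
    ((m n : ℕ) (M : Matrix F m n) → Admissible F M r → n ≤ (q ∸ 1) ^ r)
    × (∃ λ m → Σ (Matrix F m ((q ∸ 1) ^ r)) λ M → Admissible F M r)
    × ((m : ℕ) (M : Matrix F m ((q ∸ 1) ^ r)) →
        NoZeroEntries F M → HasRank F M r → DistinctColumns F M →
        Σ (Fin r → Fin m) λ u →
          (∀ i i' → u i ≡ u i' → i ≡ i') ×
          (∀ j → ∃ λ i → ∃ λ λ' →
            ∀ k → Field._≈_ F (M j k) (Field._*_ F λ' (M (u i) k))))
corollary2 F zero    (_ , indexed , _) r = ⊥-elim (Fin.¬Fin0 (proj₁ (indexed (Field.0# F))))
corollary2 F (suc p) size            r = upperBound r , attained r , extremalStructure r
  where open FiniteField F p size
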